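{- Let $G$ be a regular graph. Then $\mu_{\mathrm{int}}(G)=1$ if $G$ is Class 1, and $\mu_{\mathrm{int}}(G)=2$ if $G$ is Class 2.
   Context: Graphs are finite and simple. A $k$-improper edge coloring of a graph $G$ is a map $\alpha:E(G)\to\mathbb{N}$ such that at most $k$ edges with a common endpoint receive the same color. An edge coloring is an improper interval (edge) coloring if for every vertex $v$ the set of colors on the edges incident with $v$ is a set of consecutive integers. The interval coloring impropriety $\mu_{\mathrm{int}}(G)$ is the smallest $k$ such that $G$ has a $k$-improper interval edge coloring. A graph is Class 1 if its chromatic index equals its maximum degree $\Delta(G)$, and Class 2 if its chromatic index equals $\Delta(G)+1$. -}

module Defs where

open import Data.Nat using (ℕ; zero; suc; _+_; _≤_; _<_; _⊔_)
open import Data.Nat.Properties using (_≟_)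
open import Data.Fin using (Fin; zero; suc)
open import Data.Bool using (Bool; true; false; if_then_else_; _∧_)
open import Data.Product using (Σ; _×_; ∃-syntax)
open import Relation.Nullary using (¬_)
open import Relation.Nullary.Decidable using (⌊_⌋)
open import Relation.Binary.PropositionalEquality using (_≡_)

record Graph (n : ℕ) : Set where
  field
    adj    : Fin n → Fin n → Bool
    sym    : ∀ u v → adj u v ≡ adj v u
    irrefl : ∀ u → adj u u ≡ false
open Graph public

count : ∀ {n} → (Fin n → Bool) → ℕ
count {zero}  p = 0
count {suc n} p = (if p zero then 1 else 0) + count (λ i → p (suc i))

maxOver : ∀ {n} → (Fin n → ℕ) → ℕ
maxOver {zero}  f = 0
maxOver {suc n} f = f zero ⊔ maxOver (λ i → f (suc i))

degree : ∀ {n} → Graph n → Fin n → ℕ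
degree G u = count (λ v → adj G u v)

Δ : ∀ {n} → Graph n → ℕ
Δ G = maxOver (degree G)

Regular : ∀ {n} → Graph n → Set
Regular {n} G = ∃[ d ] (∀ (u : Fin n) → degree G u ≡ d)

-- An edge colouring: a symmetric map assigning a colour to each pair
-- (only its values on edges matter), i.e. a map E(G) → ℕ.
record EdgeColoring {n : ℕ} (G : Graph n) : Set where
  field
    col     : Fin n → Fin n → ℕ
    col-sym : ∀ u v → col u v ≡ col v u
open EdgeColoring public

colDeg : ∀ {n} {G : Graph n} → EdgeColoring G → Fin n → ℕ → ℕ
colDeg {G = G} α u c = count (λ v → adj G u v ∧ ⌊ col α u v ≟ c ⌋)

Improper : ∀ {n} {G : Graph n} → ℕ → EdgeColoring G → Set
Improper {n} k α = ∀ (u : Fin n) (c : ℕ) → colDeg α u c ≤ k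

-- interval: at every vertex the colours on incident edges form a set of
-- consecutive integers
Interval : ∀ {n} {G : Graph n} → EdgeColoring G → Set
Interval {n} {G} α =
  ∀ (u v w : Fin n) (c : ℕ) → adj G u v ≡ true → adj G u w ≡ true →
    col α u v ≤ c → c ≤ col α u w →
    ∃[ x ] (adj G u x ≡ true × col α u x ≡ c)

HasImproperInterval : ∀ {n} → Graph n → ℕ → Set
HasImproperInterval G k = Σ (EdgeColoring G) λ α → Improper k α × Interval α

IsMuInt : ∀ {n} → Graph n → ℕ → Set
IsMuInt G k = 1 ≤ k × HasImproperInterval G k ×
  (∀ k' → 1 ≤ k' → k' < k → ¬ HasImproperInterval G k')

Colorable : ∀ {n} → Graph n → ℕ → Set
Colorable {n} G k = Σ (EdgeColoring G) λ α → Improper 1 α ×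
  (∀ (u v : Fin n) → adj G u v ≡ true → col α u v < k)

IsChromaticIndex : ∀ {n} → Graph n → ℕ → Set
IsChromaticIndex G k = Colorable G k × (∀ k' → k' < k → ¬ Colorable G k')

Class1 : ∀ {n} → Graph n → Set
Class1 G = IsChromaticIndex G (Δ G)

Class2 : ∀ {n} → Graph n → Set
Class2 G = IsChromaticIndex G (suc (Δ G))

-- Let d be the common degree. A proper colouring of a d-regular graph with
-- colours 0, …, d − 1 uses all d colours at every vertex, so it is already an
-- interval colouring. A proper colouring with colours 0, …, d misses exactly one
-- colour at every vertex; merging the colours 2c and 2c + 1 into c therefore
-- yields a 2-improper interval colouring. Conversely, at a vertex of a proper
-- interval colouring the colours are d consecutive integers, so reducing every
-- colour modulo d gives a proper d-colouring, which a Class 2 graph does not have.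
module Submission where

open import Defs hiding (sym)
open import Data.Bool using (Bool; true; false; if_then_else_; _∧_)
open import Data.Fin using (Fin; zero; suc; toℕ; fromℕ<)
open import Data.Fin.Properties using (toℕ-injective; toℕ-fromℕ<; toℕ<n)
import Data.Fin.Properties as Fin
open import Data.Nat
open import Data.Nat.Properties
open import Data.Nat.DivMod using (_%_; m%n<n; m≡m%n+[m/n]*n; _/_)
open import Data.Nat.Divisibility using (_∣_; divides; ∣⇒≤)
open import Data.Product using (_×_; _,_; proj₁; proj₂; ∃-syntax)
open import Data.Sum using (_⊎_; inj₁; inj₂)
open import Function using (_∘_)
open import Relation.Binary.PropositionalEquality
open import Relation.Nullary using (¬_; Dec; yes; no; contradiction)
open import Relation.Nullary.Decidable using (⌊_⌋; map′)
open import Algebra.Properties.CommutativeMonoid.Sum +-0-commutativeMonoid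
  using (sum; sum-syntax; sum-cong-≗; ∑-comm; ∑-distrib-+)

private
  variable
    m n : ℕ

⌊≟⌋⇒≡ : ∀ {x y : ℕ} → ⌊ x ≟ y ⌋ ≡ true → x ≡ y
⌊≟⌋⇒≡ {x} {y} e with x ≟ y
... | yes x≡y = x≡y

≡⇒⌊≟⌋ : ∀ {x y : ℕ} → x ≡ y → ⌊ x ≟ y ⌋ ≡ true
≡⇒⌊≟⌋ {x} {y} x≡y with x ≟ y
... | yes _  = refl
... | no x≢y = contradiction x≡y x≢y

∧-true : ∀ {a b} → a ∧ b ≡ true → a ≡ true × b ≡ true
∧-true {true} {true} _ = refl , refl

iverson : Bool → ℕ
iverson b = if b then 1 else 0

count≡sum : (p : Fin n → Bool) → count p ≡ ∑[ i < n ] iverson (p i)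
count≡sum {zero}  p = refl
count≡sum {suc n} p = cong (iverson (p zero) +_) (count≡sum (p ∘ suc))

count-false : count {n} (λ _ → false) ≡ 0
count-false {zero}  = refl
count-false {suc n} = count-false {n}

count-pos : (p : Fin n → Bool) {i : Fin n} → p i ≡ true → 0 < count p
count-pos p {zero} pi rewrite pi = z<s
count-pos p {suc i} pi with p zero
... | true  = z<s
... | false = count-pos (p ∘ suc) pi

count-pos⇒∃ : (p : Fin n → Bool) → 0 < count p → ∃[ i ] p i ≡ true
count-pos⇒∃ {suc n} p pos with p zero in eq
... | true  = zero , eq
... | false with count-pos⇒∃ (p ∘ suc) pos
...   | i , pi = suc i , pi

count≤1⇒unique : (p : Fin n → Bool) → count p ≤ 1 →
  ∀ {i j} → p i ≡ true → p j ≡ true → i ≡ j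
count≤1⇒unique p le {zero}  {zero}  pi pj = refl
count≤1⇒unique p le {zero}  {suc j} pi pj rewrite pi =
  contradiction (≤-trans (s≤s (count-pos (p ∘ suc) pj)) le) (<-irrefl refl)
count≤1⇒unique p le {suc i} {zero}  pi pj = sym (count≤1⇒unique p le pj pi)
count≤1⇒unique p le {suc i} {suc j} pi pj with p zero
... | true  = contradiction (≤-trans (s≤s (count-pos (p ∘ suc) pi)) le) (<-irrefl refl)
... | false = cong suc (count≤1⇒unique (p ∘ suc) le pi pj)

unique⇒count≤1 : (p : Fin n → Bool) → (∀ {i j} → p i ≡ true → p j ≡ true → i ≡ j) →
  count p ≤ 1
unique⇒count≤1 {zero}  p uniq = z≤n
unique⇒count≤1 {suc n} p uniq with p zero in eq
... | true  = s≤s (≮⇒≥ λ pos → Fin.0≢1+n (uniq eq (proj₂ (count-pos⇒∃ (p ∘ suc) pos))))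
... | false = unique⇒count≤1 (p ∘ suc) λ pi pj → Fin.suc-injective (uniq pi pj)

sum-mono-≤ : {f g : Fin n → ℕ} → (∀ i → f i ≤ g i) → sum f ≤ sum g
sum-mono-≤ {zero}  le = z≤n
sum-mono-≤ {suc n} le = +-mono-≤ (le zero) (sum-mono-≤ (le ∘ suc))

n≤sum : {f : Fin n → ℕ} → (∀ i → 0 < f i) → n ≤ sum f
n≤sum {zero}  pos = z≤n
n≤sum {suc n} pos = +-mono-≤ (pos zero) (n≤sum (pos ∘ suc))

sum+zeros≡n : (f : Fin n → ℕ) → (∀ i → f i ≤ 1) → sum f + count (λ i → ⌊ f i ≟ 0 ⌋) ≡ n
sum+zeros≡n {zero}  f le = refl
sum+zeros≡n {suc n} f le with f zero | le zero | sum+zeros≡n (f ∘ suc) (le ∘ suc)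
... | 0           | _      | ih = trans (+-suc _ _) (cong suc ih)
... | 1           | _      | ih = cong suc ih
... | suc (suc _) | s≤s () | _

count-comm : (P : Fin m → Fin n → Bool) →
  ∑[ i < m ] count (P i) ≡ ∑[ j < n ] count (λ i → P i j)
count-comm {m} {n} P = begin
  ∑[ i < m ] count (P i)                 ≡⟨ sum-cong-≗ (count≡sum ∘ P) ⟩
  ∑[ i < m ] ∑[ j < n ] iverson (P i j)  ≡⟨ ∑-comm (λ i j → iverson (P i j)) ⟩
  ∑[ j < n ] ∑[ i < m ] iverson (P i j)  ≡⟨ sum-cong-≗ (λ j → sym (count≡sum (λ i → P i j))) ⟩
  ∑[ j < n ] count (λ i → P i j)         ∎
  where open ≡-Reasoning

count-≤-+ : (p q r : Fin n → Bool) → (∀ i → p i ≡ true → q i ≡ true ⊎ r i ≡ true) →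
  count p ≤ count q + count r
count-≤-+ {n} p q r cover = begin
  count p
    ≡⟨ count≡sum p ⟩
  ∑[ i < n ] iverson (p i)
    ≤⟨ sum-mono-≤ (λ i → iverson-cover (cover i)) ⟩
  ∑[ i < n ] (iverson (q i) + iverson (r i))
    ≡⟨ ∑-distrib-+ (iverson ∘ q) (iverson ∘ r) ⟩
  ∑[ i < n ] iverson (q i) + ∑[ i < n ] iverson (r i)
    ≡⟨ cong₂ _+_ (count≡sum q) (count≡sum r) ⟨
  count q + count r ∎
  where
  open ≤-Reasoning
  iverson-cover : ∀ {a b c} → (a ≡ true → b ≡ true ⊎ c ≡ true) →
    iverson a ≤ iverson b + iverson c
  iverson-cover {false} _ = z≤n
  iverson-cover {true} h with h refl
  ... | inj₁ refl = s≤s z≤n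
  ... | inj₂ refl = m≤n+m 1 _

count-∧≤iverson : ∀ b (q : Fin n → Bool) → count q ≤ 1 → count (λ i → b ∧ q i) ≤ iverson b
count-∧≤iverson {n} false q _  = ≤-reflexive (count-false {n})
count-∧≤iverson     true  q le = le

iverson≤count-∧ : ∀ b (q : Fin n → Bool) → (b ≡ true → 0 < count q) →
  iverson b ≤ count (λ i → b ∧ q i)
iverson≤count-∧ false q _   = z≤n
iverson≤count-∧ true  q pos = pos refl

count[x≟a+i]≤1 : ∀ x a B → count {B} (λ i → ⌊ x ≟ a + toℕ i ⌋) ≤ 1
count[x≟a+i]≤1 x a B = unique⇒count≤1 {B} (λ i → ⌊ x ≟ a + toℕ i ⌋) λ xi xj →
  toℕ-injective (+-cancelˡ-≡ a _ _ (trans (sym (⌊≟⌋⇒≡ xi)) (⌊≟⌋⇒≡ xj)))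

0<count[x≟i] : ∀ {x B} → x < B → 0 < count {B} (λ i → ⌊ x ≟ toℕ i ⌋)
0<count[x≟i] {x} x<B =
  count-pos (λ i → ⌊ x ≟ toℕ i ⌋) {fromℕ< x<B} (≡⇒⌊≟⌋ (sym (toℕ-fromℕ< x<B)))

module _ {G : Graph n} (α : EdgeColoring G) (u : Fin n) where

  hasColour : Fin n → ℕ → Bool
  hasColour v c = adj G u v ∧ ⌊ col α u v ≟ c ⌋

  hasColour⁺ : ∀ {v c} → adj G u v ≡ true → col α u v ≡ c → hasColour v c ≡ true
  hasColour⁺ uv vc = cong₂ _∧_ uv (≡⇒⌊≟⌋ vc)

  hasColour⁻ : ∀ {v c} → hasColour v c ≡ true → adj G u v ≡ true × col α u v ≡ c
  hasColour⁻ e = proj₁ (∧-true e) , ⌊≟⌋⇒≡ (proj₂ (∧-true e))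

  Appears : ℕ → Set
  Appears c = ∃[ v ] (adj G u v ≡ true × col α u v ≡ c)

  ColoursBelow : ℕ → Set
  ColoursBelow B = ∀ v → adj G u v ≡ true → col α u v < B

  colDeg-pos⇒appears : ∀ {c} → 0 < colDeg α u c → Appears c
  colDeg-pos⇒appears pos with count-pos⇒∃ _ pos
  ... | v , e = v , hasColour⁻ e

  appears⇒colDeg-pos : ∀ {c} → Appears c → 0 < colDeg α u c
  appears⇒colDeg-pos (v , uv , vc) = count-pos _ {v} (hasColour⁺ uv vc)

  appears? : ∀ c → Dec (Appears c)
  appears? c = map′ colDeg-pos⇒appears appears⇒colDeg-pos (0 <? colDeg α u c)

  ¬appears⇒colDeg≡0 : ∀ {c} → ¬ Appears c → colDeg α u c ≡ 0
  ¬appears⇒colDeg≡0 ¬app = n≤0⇒n≡0 (≮⇒≥ (¬app ∘ colDeg-pos⇒appears))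

  injective⇒colDeg≤1 : (∀ {v w} → adj G u v ≡ true → adj G u w ≡ true →
                         col α u v ≡ col α u w → v ≡ w) →
                       ∀ c → colDeg α u c ≤ 1
  injective⇒colDeg≤1 inj c = unique⇒count≤1 _ λ ev ew →
    let uv , vc = hasColour⁻ ev; uw , wc = hasColour⁻ ew in inj uv uw (trans vc (sym wc))

  proper⇒injective : Improper 1 α → ∀ {v w} → adj G u v ≡ true → adj G u w ≡ true →
    col α u v ≡ col α u w → v ≡ w
  proper⇒injective proper {v} uv uw vw =
    count≤1⇒unique _ (proper u (col α u v)) (hasColour⁺ uv refl) (hasColour⁺ uw (sym vw))

  ∑colDeg≤degree : ∀ a B → ∑[ i < B ] colDeg α u (a + toℕ i) ≤ degree G u
  ∑colDeg≤degree a B = begin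
    ∑[ i < B ] colDeg α u (a + toℕ i)
      ≡⟨ count-comm {B} (λ i v → hasColour v (a + toℕ i)) ⟩
    ∑[ v < n ] count {B} (λ i → hasColour v (a + toℕ i))
      ≤⟨ sum-mono-≤ (λ v →
           count-∧≤iverson {B} (adj G u v) _ (count[x≟a+i]≤1 (col α u v) a B)) ⟩
    ∑[ v < n ] iverson (adj G u v)
      ≡⟨ count≡sum (adj G u) ⟨
    degree G u ∎
    where open ≤-Reasoning

  degree≤∑colDeg : ∀ B → ColoursBelow B → degree G u ≤ ∑[ i < B ] colDeg α u (toℕ i)
  degree≤∑colDeg B bounded = begin
    degree G u
      ≡⟨ count≡sum (adj G u) ⟩
    ∑[ v < n ] iverson (adj G u v)
      ≤⟨ sum-mono-≤ (λ v → iverson≤count-∧ {B} (adj G u v) _ (0<count[x≟i] ∘ bounded v)) ⟩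
    ∑[ v < n ] count {B} (λ i → hasColour v (toℕ i))
      ≡⟨ count-comm {B} (λ i v → hasColour v (toℕ i)) ⟨
    ∑[ i < B ] colDeg α u (toℕ i) ∎
    where open ≤-Reasoning

  interval⇒span<degree : Interval α → ∀ {v w} → adj G u v ≡ true → adj G u w ≡ true →
    col α u v ≤ col α u w → col α u w ∸ col α u v < degree G u
  interval⇒span<degree interval {v} {w} uv uw v≤w = begin-strict
    k                                      <⟨ n<1+n k ⟩
    suc k                                  ≤⟨ n≤sum (appears⇒colDeg-pos ∘ inSpan) ⟩
    ∑[ i < suc k ] colDeg α u (a + toℕ i)  ≤⟨ ∑colDeg≤degree a (suc k) ⟩
    degree G u                             ∎
    where
    open ≤-Reasoning
    a k : ℕ
    a = col α u v
    k = col α u w ∸ a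
    inSpan : (i : Fin (suc k)) → Appears (a + toℕ i)
    inSpan i = interval u v w (a + toℕ i) uv uw (m≤m+n a _) (begin
      a + toℕ i  ≤⟨ +-monoʳ-≤ a (s≤s⁻¹ (toℕ<n i)) ⟩
      a + k      ≡⟨ m+[n∸m]≡n v≤w ⟩
      col α u w  ∎)

  missing : ∀ {B} → Fin B → Bool
  missing i = ⌊ colDeg α u (toℕ i) ≟ 0 ⌋

  missing-fromℕ< : ∀ {c B} (c<B : c < B) → ¬ Appears c → missing (fromℕ< c<B) ≡ true
  missing-fromℕ< c<B ¬app =
    ≡⇒⌊≟⌋ (trans (cong (colDeg α u) (toℕ-fromℕ< c<B)) (¬appears⇒colDeg≡0 ¬app))

  module _ (proper : Improper 1 α) where

    degree+missing≡width : ∀ B → ColoursBelow B → degree G u + count (missing {B}) ≡ B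
    degree+missing≡width B bounded = begin
      degree G u + count (missing {B})
        ≡⟨ cong (_+ count (missing {B})) degree≡∑colDeg ⟩
      ∑[ i < B ] colDeg α u (toℕ i) + count (missing {B})
        ≡⟨ sum+zeros≡n _ (proper u ∘ toℕ) ⟩
      B ∎
      where
      open ≡-Reasoning
      degree≡∑colDeg : degree G u ≡ ∑[ i < B ] colDeg α u (toℕ i)
      degree≡∑colDeg = ≤-antisym (degree≤∑colDeg B bounded) (∑colDeg≤degree 0 B)

    colour<degree⇒appears : ColoursBelow (degree G u) → ∀ {c} → c < degree G u → Appears c
    colour<degree⇒appears bounded {c} c<d with appears? c
    ... | yes app = app
    ... | no ¬app =
      contradiction (subst (0 <_) noneMissing (count-pos missing (missing-fromℕ< c<d ¬app)))
                    (<-irrefl refl)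
      where
      d : ℕ
      d = degree G u
      noneMissing : count (missing {d}) ≡ 0
      noneMissing = +-cancelˡ-≡ d _ 0
        (trans (degree+missing≡width d bounded) (sym (+-identityʳ d)))

    missingColour-unique : ColoursBelow (suc (degree G u)) →
      ∀ {x y} → x < suc (degree G u) → y < suc (degree G u) →
      ¬ Appears x → ¬ Appears y → x ≡ y
    missingColour-unique bounded {x} {y} x<B y<B ¬x ¬y = begin
      x                  ≡⟨ toℕ-fromℕ< x<B ⟨
      toℕ (fromℕ< x<B)   ≡⟨ cong toℕ (count≤1⇒unique missing atMostOneMissing
                                        (missing-fromℕ< x<B ¬x) (missing-fromℕ< y<B ¬y)) ⟩
      toℕ (fromℕ< y<B)   ≡⟨ toℕ-fromℕ< y<B ⟩
      y                  ∎
      where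
      open ≡-Reasoning
      d : ℕ
      d = degree G u
      atMostOneMissing : count (missing {suc d}) ≤ 1
      atMostOneMissing = ≤-reflexive (+-cancelˡ-≡ d _ 1
        (trans (degree+missing≡width (suc d) bounded) (+-comm 1 d)))

≤-maxOver : (f : Fin n → ℕ) (i : Fin n) → f i ≤ maxOver f
≤-maxOver f zero    = m≤m⊔n _ _
≤-maxOver f (suc i) = ≤-trans (≤-maxOver (f ∘ suc) i) (m≤n⊔m (f zero) _)

maxOver-lub : ∀ (f : Fin n → ℕ) {d} → (∀ i → f i ≤ d) → maxOver f ≤ d
maxOver-lub {zero}  f le = z≤n
maxOver-lub {suc n} f le = ⊔-lub (le zero) (maxOver-lub (f ∘ suc) (le ∘ suc))

regular⇒Δ≡degree : (G : Graph n) → Regular G → ∀ u → Δ G ≡ degree G u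
regular⇒Δ≡degree G (d , deg≡d) u = ≤-antisym
  (maxOver-lub (degree G) λ v → ≤-reflexive (trans (deg≡d v) (sym (deg≡d u))))
  (≤-maxOver (degree G) u)

⌊n/2⌋-parity : ∀ x → x ≡ ⌊ x /2⌋ + ⌊ x /2⌋ ⊎ x ≡ suc (⌊ x /2⌋ + ⌊ x /2⌋)
⌊n/2⌋-parity zero          = inj₁ refl
⌊n/2⌋-parity (suc zero)    = inj₂ refl
⌊n/2⌋-parity (suc (suc x)) with ⌊n/2⌋-parity x
... | inj₁ even = inj₁ (cong suc (trans (cong suc even) (sym (+-suc ⌊ x /2⌋ ⌊ x /2⌋))))
... | inj₂ odd  = inj₂ (cong suc (trans (cong suc odd) (cong suc (sym (+-suc ⌊ x /2⌋ ⌊ x /2⌋)))))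

halve : {G : Graph n} → EdgeColoring G → EdgeColoring G
halve α = record
  { col     = λ u v → ⌊ col α u v /2⌋
  ; col-sym = λ u v → cong ⌊_/2⌋ (col-sym α u v)
  }

halve-improper : {k : ℕ} {G : Graph n} {α : EdgeColoring G} →
  Improper k α → Improper (k + k) (halve α)
halve-improper {α = α} improper u c =
  ≤-trans (count-≤-+ _ _ _ cover) (+-mono-≤ (improper u (c + c)) (improper u (suc (c + c))))
  where
  cover : ∀ v → hasColour (halve α) u v c ≡ true →
    hasColour α u v (c + c) ≡ true ⊎ hasColour α u v (suc (c + c)) ≡ true
  cover v e with hasColour⁻ (halve α) u e | ⌊n/2⌋-parity (col α u v)
  ... | uv , refl | inj₁ even = inj₁ (hasColour⁺ α u uv even)
  ... | uv , refl | inj₂ odd  = inj₂ (hasColour⁺ α u uv odd)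

halve-interval-at : {G : Graph n} (α : EdgeColoring G) (u : Fin n) → Improper 1 α →
  ColoursBelow α u (suc (degree G u)) →
  ∀ {w c} → adj G u w ≡ true → c ≤ ⌊ col α u w /2⌋ → Appears (halve α) u c
halve-interval-at {G = G} α u proper bounded {w} {c} uw c≤w
  with appears? α u (c + c) | appears? α u (suc (c + c))
... | yes (x , ux , even) | _ = x , ux , trans (cong ⌊_/2⌋ even) (sym (n≡⌊n+n/2⌋ c))
... | no _ | yes (x , ux , odd) = x , ux , trans (cong ⌊_/2⌋ odd) (sym (n≡⌈n+n/2⌉ c))
... | no ¬even | no ¬odd = contradiction
  (missingColour-unique α u proper bounded (<-trans (n<1+n _) odd<) odd< ¬even ¬odd)
  (1+n≢n ∘ sym)
  where
  even≤ : c + c ≤ col α u w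
  even≤ = ≤-trans (+-mono-≤ c≤w (≤-trans c≤w (⌊n/2⌋≤⌈n/2⌉ _))) (≤-reflexive (⌊n/2⌋+⌈n/2⌉≡n _))
  odd< : suc (c + c) < suc (degree G u)
  odd< = ≤-<-trans (≤∧≢⇒< even≤ λ e → ¬even (w , uw , sym e)) (bounded w uw)

%≡%⇒∣∸ : ∀ a b D .{{_ : NonZero D}} → a % D ≡ b % D → D ∣ b ∸ a
%≡%⇒∣∸ a b D eq = divides (b / D ∸ a / D) (begin
  b ∸ a                                      ≡⟨ cong₂ _∸_ (m≡m%n+[m/n]*n b D) (m≡m%n+[m/n]*n a D) ⟩
  (b % D + b / D * D) ∸ (a % D + a / D * D)  ≡⟨ cong (λ r → _ ∸ (r + a / D * D)) eq ⟩
  (b % D + b / D * D) ∸ (b % D + a / D * D)  ≡⟨ [m+n]∸[m+o]≡n∸o (b % D) _ _ ⟩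
  b / D * D ∸ a / D * D                      ≡⟨ *-distribʳ-∸ D (b / D) (a / D) ⟨
  (b / D ∸ a / D) * D                        ∎)
  where open ≡-Reasoning

%-injective-window : ∀ {a b D} .{{_ : NonZero D}} → a ≤ b → b ∸ a < D → a % D ≡ b % D → a ≡ b
%-injective-window {a} {b} {D} a≤b span<D eq with b ∸ a in span≡ | %≡%⇒∣∸ a b D eq
... | zero  | _      = ≤-antisym a≤b (m∸n≡0⇒m≤n span≡)
... | suc _ | D∣span = contradiction (∣⇒≤ D∣span) (<⇒≱ span<D)

reduceMod : (D : ℕ) .{{_ : NonZero D}} {G : Graph n} → EdgeColoring G → EdgeColoring G
reduceMod D α = record
  { col     = λ u v → col α u v % D
  ; col-sym = λ u v → cong (_% D) (col-sym α u v)
  }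

properInterval⇒colourable : {G : Graph n} (α : EdgeColoring G) → Improper 1 α → Interval α →
  ∀ D → (∀ u → degree G u ≤ D) → Colorable G D
properInterval⇒colourable {G = G} α proper interval zero deg≤0 =
  α , proper , λ u v uv → contradiction (≤-trans (count-pos (adj G u) uv) (deg≤0 u)) (<-irrefl refl)
properInterval⇒colourable {G = G} α proper interval D@(suc _) deg≤D =
  reduceMod D α , injective⇒colDeg≤1 (reduceMod D α) _ ∘ injective , λ u v _ → m%n<n (col α u v) D
  where
  span<D : ∀ u {v w} → adj G u v ≡ true → adj G u w ≡ true → col α u v ≤ col α u w →
    col α u w ∸ col α u v < D
  span<D u uv uw v≤w = <-≤-trans (interval⇒span<degree α u interval uv uw v≤w) (deg≤D u)
  injective : ∀ u {v w} → adj G u v ≡ true → adj G u w ≡ true →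
    col α u v % D ≡ col α u w % D → v ≡ w
  injective u {v} {w} uv uw eq with ≤-total (col α u v) (col α u w)
  ... | inj₁ v≤w = proper⇒injective α u proper uv uw
                     (%-injective-window v≤w (span<D u uv uw v≤w) eq)
  ... | inj₂ w≤v = sym (proper⇒injective α u proper uw uv
                     (%-injective-window w≤v (span<D u uw uv w≤v) (sym eq)))

class1⇒μint≡1 : {G : Graph n} → Regular G → Class1 G → IsMuInt G 1
class1⇒μint≡1 {G = G} regular ((α , proper , bounded) , _) =
  ≤-refl , (α , proper , interval) , λ k 1≤k k<1 _ → <⇒≱ k<1 1≤k
  where
  bounded′ : ∀ u → ColoursBelow α u (degree G u)
  bounded′ u x ux = subst (col α u x <_) (regular⇒Δ≡degree G regular u) (bounded u x ux)
  interval : Interval α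
  interval u _ w c _ uw _ c≤w =
    colour<degree⇒appears α u proper (bounded′ u) (≤-<-trans c≤w (bounded′ u w uw))

class2⇒2-interval : {G : Graph n} → Regular G → Class2 G → HasImproperInterval G 2
class2⇒2-interval {G = G} regular ((α , proper , bounded) , _) =
  halve α , halve-improper {α = α} proper , λ u _ w c _ uw _ c≤w →
    halve-interval-at α u proper (bounded′ u) uw c≤w
  where
  bounded′ : ∀ u → ColoursBelow α u (suc (degree G u))
  bounded′ u x ux = subst (λ d → col α u x < suc d) (regular⇒Δ≡degree G regular u) (bounded u x ux)

class2⇒¬1-interval : {G : Graph n} → Class2 G → ¬ HasImproperInterval G 1
class2⇒¬1-interval {G = G} (_ , minimal) (α , proper , interval) =
  minimal (Δ G) (n<1+n (Δ G))
    (properInterval⇒colourable α proper interval (Δ G) (≤-maxOver (degree G)))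

proposition6 : ∀ {n : ℕ} (G : Graph n) → Regular G →
    (Class1 G → IsMuInt G 1) × (Class2 G → IsMuInt G 2)
proposition6 G regular =
  class1⇒μint≡1 regular ,
  λ class2 → s≤s z≤n , class2⇒2-interval regular class2 , λ where
    1             _ _                → class2⇒¬1-interval class2
    (suc (suc _)) _ (s≤s (s≤s ()))
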